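{- For every $m\ge2$, writing $f_1=f_1^m$, the minimal elements $q_1,q_2,q_3,q_4$ of $\mathcal{Q}_1^m,\dots,\mathcal{Q}_4^m$ satisfy: (1) $q_1$ is the word obtained from $f_1$ by deleting its first letter $1$ and appending the letter $1$; (2) $q_2$ is obtained from $f_1$ by deleting its first two letters $10$ and appending $11$; (3) $q_3=f_1$; (4) $q_4$ is obtained from $f_1$ by deleting its first three letters $100$ and appending $110$. In group notation: $q_1=1^{ -1}f_1 1$, $q_2=(10)^{ -1}f_1 11$, $q_3=f_1$, $q_4=(100)^{ -1}f_1 110$.
   Context: The Thue-Morse substitution is $\theta(0)=01$, $\theta(1)=10$; its two one-sided infinite fixed points are $f_0^\omega=0110\dots$ and $f_1^\omega=1001\dots$. For $m\ge2$, $\mathcal{A}_m$ is the set of subwords of length $2^m+1$ of the Thue-Morse sequence $0110100110010110\dots$; it has $3\cdot 2^m$ elements, listed in lexicographic order (with $0<1$) as $w^m_1<w^m_2<\dots<w^m_{|\mathcal{A}_m|}$. $\mathcal{A}_m$ is partitioned into four blocks of consecutive words of equal size: $\mathcal{Q}^m_k=\{w^m_j:(k-1)\tfrac14|\mathcal{A}_m|<j\le k\tfrac14|\mathcal{A}_m|\}$ for $k=1,2,3,4$, and $q_k=\min\mathcal{Q}^m_k$. $f_0^m$ and $f_1^m$ denote the prefixes of length $2^m+1$ of $f_0^\omega$ and $f_1^\omega$ respectively. -}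

module Defs where

open import Data.Bool using (Bool; true; false; not)
open import Data.Nat using (ℕ; zero; suc; _+_; _^_)
open import Data.List using (List; []; _∷_; concatMap; map; upTo)
open import Data.Maybe using (Maybe; just; nothing)
open import Data.Product using (∃)
open import Relation.Binary.PropositionalEquality using (_≡_)
open import Data.List.Relation.Unary.Linked using (Linked)
open import Data.List.Membership.Propositional using (_∈_)
open import Function.Bundles using (_⇔_)

-- Letters: false = 0, true = 1.  Words are lists of letters.
Word : Set
Word = List Bool

θ₁ : Bool → Word
θ₁ false = false ∷ true ∷ []
θ₁ true  = true ∷ false ∷ []

θ : Word → Word
θ = concatMap θ₁

iterθ : ℕ → Word → Word
iterθ zero    w = w
iterθ (suc k) w = θ (iterθ k w)

-- n-th letter (0-indexed) of a word, with default 0 if out of range.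
nth : ℕ → Word → Bool
nth _       []       = false
nth zero    (x ∷ _)  = x
nth (suc n) (_ ∷ xs) = nth n xs

-- Thue-Morse sequence f₀^ω = 0110...: its n-th letter is the n-th letter
-- of θ^(n+1)(0), which has length 2^(n+1) > n.
tm : ℕ → Bool
tm n = nth n (iterθ (suc n) (false ∷ []))

-- The other fixed point f₁^ω = 1001...
tm₁ : ℕ → Bool
tm₁ n = not (tm n)

window : (ℕ → Bool) → ℕ → ℕ → Word
window s i L = map (λ j → s (i + j)) (upTo L)

IsFactor : ℕ → Word → Set
IsFactor L w = ∃ λ i → w ≡ window tm i L

_<ᵇ_ : Bool → Bool → Set
x <ᵇ y = x ≡ false × y ≡ true
  where open import Data.Product using (_×_)

data _<lex_ : Word → Word → Set where
  []<∷  : ∀ {y ys} → [] <lex (y ∷ ys)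
  here  : ∀ {x y xs ys} → x <ᵇ y → (x ∷ xs) <lex (y ∷ ys)
  there : ∀ {x xs ys} → xs <lex ys → (x ∷ xs) <lex (x ∷ ys)

-- 𝒜_m as a list listed in increasing lexicographic order:
-- ws is strictly increasing and its members are exactly the subwords of
-- length 2^m + 1 of the Thue-Morse sequence.
IsSortedEnumA : ℕ → List Word → Set
IsSortedEnumA m ws =
  Linked _<lex_ ws × (∀ w → (w ∈ ws) ⇔ IsFactor (2 ^ m + 1) w)
  where open import Data.Product using (_×_)

_‼_ : ∀ {A : Set} → List A → ℕ → Maybe A
[]       ‼ _     = nothing
(x ∷ _)  ‼ zero  = just x
(_ ∷ xs) ‼ suc n = xs ‼ n

f₁ : ℕ → Word
f₁ m = window tm₁ 0 (2 ^ m + 1)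

module Submission where

-- A factor of length 2N+1 of the Thue-Morse sequence t starts at an even
-- position 2i, and is then θ(v) without its last letter (evenImage v), or at
-- an odd position 2i+1, and is then θ(v) without its first letter
-- (oddImage v), where v is the factor of length N+1 at position i.  Listing
-- the factors of length N+1 that begin with 0 as low and those that begin
-- with 1 as high, both sorted, the sorted factors of length 2N+1 are
--     map oddImage high ++ map evenImage low ++ map evenImage high ++ map oddImage low,
-- four blocks of equal length |high| = |low|.  The block comparisons only use
-- the first letter and that no factor begins with 000 or 111.  So the quarter
-- boundaries of 𝒜_m are the first elements of the four blocks, which are
-- images of the first elements f₁ of high and q₁ f₁ of low.

open import Defs
open import Data.Bool using (Bool; true; false; not)
open import Data.Bool.Properties using (not-¬)
open import Data.Nat using (ℕ; zero; suc; _+_; _*_; _^_; _/_; _≤_; _<_; _≤′_; z≤n; s≤s; ≤′-refl; ≤′-step)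
open import Data.Nat.Properties
  using (+-comm; +-suc; +-identityʳ; *-comm; ≤-trans; ≤-<-trans; n≤1+n; ≤⇒≤′; m≤m⊔n; m≤n⊔m)
open import Data.Nat.DivMod using (m*n/n≡m)
open import Data.List using (List; []; _∷_; _++_; drop; length; map; applyUpTo)
open import Data.List.Properties using (++-assoc; ++-identityʳ; length-++; length-map)
open import Data.Maybe using (just)
open import Data.Product using (∃; _×_; _,_; proj₁; proj₂)
open import Data.Sum using (_⊎_; inj₁; inj₂)
open import Data.Empty using (⊥-elim)
open import Relation.Nullary using (¬_)
open import Relation.Binary.PropositionalEquality
open import Function.Bundles using (Equivalence)
open import Data.List.Relation.Unary.All as All using (All; []; _∷_)
import Data.List.Relation.Unary.All.Properties as All
open import Data.List.Relation.Unary.AllPairs as AllPairs using (AllPairs; []; _∷_)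
import Data.List.Relation.Unary.AllPairs.Properties as AllPairs
open import Data.List.Relation.Unary.Any using (here; there)
open import Data.List.Relation.Unary.Linked.Properties using (Linked⇒AllPairs)
open import Data.List.Membership.Propositional using (_∈_)
open import Data.List.Membership.Propositional.Properties using (∈-map⁺; ∈-++⁺ˡ; ∈-++⁺ʳ; ∈-++⁻)

-- n ↦ 2n, by a recursion that makes 2(n+1) = 2n + 2 definitional.
dbl : ℕ → ℕ
dbl zero    = zero
dbl (suc n) = suc (suc (dbl n))

dbl≡2* : ∀ n → dbl n ≡ 2 * n
dbl≡2* zero    = refl
dbl≡2* (suc n) = cong suc (trans (cong suc (dbl≡2* n)) (sym (+-suc n (n + 0))))

n≤dbl : ∀ n → n ≤ dbl n
n≤dbl zero    = z≤n
n≤dbl (suc n) = s≤s (≤-trans (n≤dbl n) (n≤1+n _))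

parity : ∀ i → ∃ λ j → i ≡ dbl j ⊎ i ≡ suc (dbl j)
parity zero          = zero , inj₁ refl
parity (suc zero)    = zero , inj₂ refl
parity (suc (suc i)) with parity i
... | j , inj₁ refl = suc j , inj₁ refl
... | j , inj₂ refl = suc j , inj₂ refl

-- θ with the image of a letter written as x (not x), so that it computes on
-- words whose letters are variables.
thue : Word → Word
thue []       = []
thue (x ∷ xs) = x ∷ not x ∷ thue xs

θ≡thue : ∀ w → θ w ≡ thue w
θ≡thue []          = refl
θ≡thue (false ∷ w) = cong (λ u → false ∷ true ∷ u) (θ≡thue w)
θ≡thue (true ∷ w)  = cong (λ u → true ∷ false ∷ u) (θ≡thue w)

thue-++ : ∀ u v → thue (u ++ v) ≡ thue u ++ thue v
thue-++ []      v = refl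
thue-++ (x ∷ u) v = cong (λ w → x ∷ not x ∷ w) (thue-++ u v)

length-thue : ∀ w → length (thue w) ≡ dbl (length w)
length-thue []      = refl
length-thue (x ∷ w) = cong (λ n → suc (suc n)) (length-thue w)

nth-thue-even : ∀ i w → i < length w → nth (dbl i) (thue w) ≡ nth i w
nth-thue-even zero    (x ∷ w) _       = refl
nth-thue-even (suc i) (x ∷ w) (s≤s h) = nth-thue-even i w h

nth-thue-odd : ∀ i w → i < length w → nth (suc (dbl i)) (thue w) ≡ not (nth i w)
nth-thue-odd zero    (x ∷ w) _       = refl
nth-thue-odd (suc i) (x ∷ w) (s≤s h) = nth-thue-odd i w h

_≼_ : Word → Word → Set
u ≼ w = ∃ λ r → w ≡ u ++ r

≼-trans : ∀ {u v w} → u ≼ v → v ≼ w → u ≼ w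
≼-trans {u} (r , refl) (s , refl) = r ++ s , ++-assoc u r s

thue-≼ : ∀ {u w} → u ≼ w → thue u ≼ thue w
thue-≼ {u} (r , refl) = thue r , thue-++ u r

nth-≼ : ∀ n {u w} → u ≼ w → n < length u → nth n w ≡ nth n u
nth-≼ zero    {x ∷ u} (r , refl) _       = refl
nth-≼ (suc n) {x ∷ u} (r , refl) (s≤s h) = nth-≼ n {u} (r , refl) h

block : ℕ → Word
block k = iterθ k (false ∷ [])

block-suc : ∀ k → block (suc k) ≡ thue (block k)
block-suc k = θ≡thue (block k)

block-≼-suc : ∀ k → block k ≼ block (suc k)
block-≼-suc zero    = true ∷ [] , refl
block-≼-suc (suc k) =
  subst₂ _≼_ (sym (block-suc k)) (sym (block-suc (suc k))) (thue-≼ (block-≼-suc k))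

block-≼ : ∀ {k l} → k ≤′ l → block k ≼ block l
block-≼ ≤′-refl      = [] , sym (++-identityʳ _)
block-≼ (≤′-step {l} k≤l) = ≼-trans (block-≼ k≤l) (block-≼-suc l)

block-long : ∀ k → k < length (block k)
block-long zero    = s≤s z≤n
block-long (suc k) =
  subst (suc k <_) (sym (trans (cong length (block-suc k)) (length-thue (block k))))
        (<-dbl (block-long k))
  where
  <-dbl : ∀ {k n} → k < n → suc k < dbl n
  <-dbl {n = suc n} (s≤s k≤n) = s≤s (s≤s (≤-trans k≤n (n≤dbl n)))

-- Every θᵏ(0) long enough agrees with t at position n, since all of them are
-- prefixes of a common θᴷ(0).
tm-block : ∀ n k → n < length (block k) → nth n (block k) ≡ tm n
tm-block n k h =
  trans (sym (nth-≼ n (block-≼ (≤⇒≤′ (m≤m⊔n k (suc n)))) h))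
        (nth-≼ n (block-≼ (≤⇒≤′ (m≤n⊔m k (suc n)))) (≤-trans (n≤1+n _) (block-long (suc n))))

tm-even : ∀ i → tm (dbl i) ≡ tm i
tm-even i = begin
  nth (dbl i) (block (suc (dbl i)))   ≡⟨ cong (nth (dbl i)) (block-suc (dbl i)) ⟩
  nth (dbl i) (thue (block (dbl i)))  ≡⟨ nth-thue-even i (block (dbl i)) i<len ⟩
  nth i (block (dbl i))               ≡⟨ tm-block i (dbl i) i<len ⟩
  tm i                                ∎
  where
  open ≡-Reasoning
  i<len : i < length (block (dbl i))
  i<len = ≤-<-trans (n≤dbl i) (block-long (dbl i))

tm-odd : ∀ i → tm (suc (dbl i)) ≡ not (tm i)
tm-odd i = begin
  nth (suc (dbl i)) (block (suc (suc (dbl i))))  ≡⟨ cong (nth (suc (dbl i))) (block-suc (suc (dbl i))) ⟩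
  nth (suc (dbl i)) (thue (block (suc (dbl i)))) ≡⟨ nth-thue-odd i (block (suc (dbl i))) i<len ⟩
  not (nth i (block (suc (dbl i))))              ≡⟨ cong not (tm-block i (suc (dbl i)) i<len) ⟩
  not (tm i)                                     ∎
  where
  open ≡-Reasoning
  i<len : i < length (block (suc (dbl i)))
  i<len = ≤-<-trans (≤-trans (n≤dbl i) (n≤1+n _)) (block-long (suc (dbl i)))

tm₁-even : ∀ i → tm₁ (dbl i) ≡ tm₁ i
tm₁-even i = cong not (tm-even i)

tm₁-odd : ∀ i → tm₁ (suc (dbl i)) ≡ not (tm₁ i)
tm₁-odd i = cong not (tm-odd i)

slice : (ℕ → Bool) → ℕ → ℕ → Word
slice s i zero    = []
slice s i (suc L) = s i ∷ slice s (suc i) L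

window≡slice : ∀ s i L → window s i L ≡ slice s i L
window≡slice s i L = map-slice L i (λ j → j) (λ _ → refl)
  where
  -- applyUpTo h L enumerates h 0, …, h (L-1), which here are the positions
  -- k, …, k+L-1 shifted by i.
  map-slice : ∀ L k (h : ℕ → ℕ) → (∀ j → i + h j ≡ k + j) →
              map (λ j → s (i + j)) (applyUpTo h L) ≡ slice s k L
  map-slice zero    k h h≗ = refl
  map-slice (suc L) k h h≗ =
    cong₂ _∷_ (cong s (trans (h≗ 0) (+-identityʳ k)))
              (map-slice L (suc k) (λ j → h (suc j)) (λ j → trans (h≗ (suc j)) (+-suc k j)))

∷∷-cong : ∀ {a a′ b b′ : Bool} {w w′ : Word} → a ≡ a′ → b ≡ b′ → w ≡ w′ →
          _≡_ {A = Word} (a ∷ b ∷ w) (a′ ∷ b′ ∷ w′)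
∷∷-cong refl refl refl = refl

evenImageTail : Bool → Word → Word
evenImageTail x []      = []
evenImageTail x (y ∷ r) = not x ∷ y ∷ evenImageTail y r

-- θ(v) without its last letter: the factor at position 2i when v is the
-- factor at position i.
evenImage : Word → Word
evenImage []      = []
evenImage (x ∷ r) = x ∷ evenImageTail x r

-- θ(v) without its first letter: the factor at position 2i+1.
oddImage : Word → Word
oddImage []      = []
oddImage (x ∷ r) = not x ∷ thue r

evenImage-snoc : ∀ u z → evenImage (u ++ z ∷ []) ≡ thue u ++ z ∷ []
evenImage-snoc []      z = refl
evenImage-snoc (x ∷ u) z = cong (x ∷_) (tail-snoc x u)
  where
  tail-snoc : ∀ x u → evenImageTail x (u ++ z ∷ []) ≡ not x ∷ (thue u ++ z ∷ [])
  tail-snoc x []      = refl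
  tail-snoc x (y ∷ u) = cong (λ w → not x ∷ y ∷ w) (tail-snoc y u)

module Recurrence (s : ℕ → Bool)
                  (s-even : ∀ i → s (dbl i) ≡ s i)
                  (s-odd : ∀ i → s (suc (dbl i)) ≡ not (s i)) where

  thue-slice : ∀ L i → thue (slice s i L) ≡ slice s (dbl i) (dbl L)
  thue-slice zero    i = refl
  thue-slice (suc L) i = ∷∷-cong (sym (s-even i)) (sym (s-odd i)) (thue-slice L (suc i))

  evenImage-slice : ∀ L i → evenImage (slice s i (suc L)) ≡ slice s (dbl i) (suc (dbl L))
  evenImage-slice L i = cong₂ _∷_ (sym (s-even i)) (tail-slice L i)
    where
    tail-slice : ∀ L i → evenImageTail (s i) (slice s (suc i) L) ≡ slice s (suc (dbl i)) (dbl L)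
    tail-slice zero    i = refl
    tail-slice (suc L) i = ∷∷-cong (sym (s-odd i)) (sym (s-even (suc i))) (tail-slice L (suc i))

  oddImage-slice : ∀ L i → oddImage (slice s i (suc L)) ≡ slice s (suc (dbl i)) (suc (dbl L))
  oddImage-slice L i = cong₂ _∷_ (sym (s-odd i)) (thue-slice L (suc i))

  -- No three consecutive letters are equal: among them, two are at
  -- positions 2j and 2j+1.
  no-cube : ∀ i → ¬ (s i ≡ s (suc i) × s (suc i) ≡ s (suc (suc i)))
  no-cube i with parity i
  ... | j , inj₁ refl = λ (e , _) → not-¬ refl (trans (sym (s-even j)) (trans e (s-odd j)))
  ... | j , inj₂ refl = λ (_ , e) → not-¬ refl (trans (sym (s-even (suc j))) (trans e (s-odd (suc j))))

module TM  = Recurrence tm  tm-even  tm-odd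
module TM₁ = Recurrence tm₁ tm₁-even tm₁-odd

Factor : ℕ → Word → Set
Factor N w = ∃ λ i → w ≡ slice tm i (suc N)

factor-even : ∀ {N v} → Factor N v → Factor (dbl N) (evenImage v)
factor-even {N} (i , refl) = dbl i , TM.evenImage-slice N i

factor-odd : ∀ {N v} → Factor N v → Factor (dbl N) (oddImage v)
factor-odd {N} (i , refl) = suc (dbl i) , TM.oddImage-slice N i

factor-split : ∀ {N w} → Factor (dbl N) w →
               ∃ λ v → Factor N v × (w ≡ evenImage v ⊎ w ≡ oddImage v)
factor-split {N} (i , refl) with parity i
... | j , inj₁ refl = slice tm j (suc N) , (j , refl) , inj₁ (sym (TM.evenImage-slice N j))
... | j , inj₂ refl = slice tm j (suc N) , (j , refl) , inj₂ (sym (TM.oddImage-slice N j))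

lex-trans : ∀ {x y z} → x <lex y → y <lex z → x <lex z
lex-trans []<∷              (here _)          = []<∷
lex-trans []<∷              (there _)         = []<∷
lex-trans (here (_ , refl)) (here (() , _))
lex-trans (here x<y)        (there _)         = here x<y
lex-trans (there _)         (here x<y)        = here x<y
lex-trans (there x<y)       (there y<z)       = there (lex-trans x<y y<z)

lex-irrefl : ∀ {x} → ¬ (x <lex x)
lex-irrefl (here (refl , ()))
lex-irrefl (there x<x) = lex-irrefl x<x

Sorted : List Word → Set
Sorted = AllPairs _<lex_

∈-tail : ∀ {x w ys} → x <lex w → w ∈ x ∷ ys → w ∈ ys
∈-tail x<w (here refl) = ⊥-elim (lex-irrefl x<w)
∈-tail x<w (there w∈ys) = w∈ys

-- Two sorted lists with the same members are equal: both heads are the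
-- least member, and the tails again have the same members.
sorted-unique : ∀ {xs ys} → Sorted xs → Sorted ys →
                (∀ {w} → w ∈ xs → w ∈ ys) → (∀ {w} → w ∈ ys → w ∈ xs) → xs ≡ ys
sorted-unique {[]}     {[]}     _ _ _   _   = refl
sorted-unique {[]}     {y ∷ ys} _ _ _   ys⊆ with ys⊆ (here refl)
... | ()
sorted-unique {x ∷ xs} {[]}     _ _ xs⊆ _   with xs⊆ (here refl)
... | ()
sorted-unique {x ∷ xs} {y ∷ ys} (x< ∷ xs↗) (y< ∷ ys↗) xs⊆ ys⊆ =
  cong₂ _∷_ x≡y (sorted-unique xs↗ ys↗ tail⊆ tail⊇)
  where
  x≡y : x ≡ y
  x≡y with xs⊆ (here refl) | ys⊆ (here refl)
  ... | here x≡y    | _           = x≡y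
  ... | there _     | here y≡x    = sym y≡x
  ... | there x∈ys  | there y∈xs  =
    ⊥-elim (lex-irrefl (lex-trans (All.lookup y< x∈ys) (All.lookup x< y∈xs)))
  tail⊆ : ∀ {w} → w ∈ xs → w ∈ ys
  tail⊆ w∈xs = ∈-tail (subst (_<lex _) x≡y (All.lookup x< w∈xs)) (xs⊆ (there w∈xs))
  tail⊇ : ∀ {w} → w ∈ ys → w ∈ xs
  tail⊇ w∈ys = ∈-tail (subst (_<lex _) (sym x≡y) (All.lookup y< w∈ys)) (ys⊆ (there w∈ys))

sorted-map : ∀ {P : Word → Set} (f : Word → Word) →
             (∀ {x y} → P x → P y → x <lex y → f x <lex f y) →
             ∀ {xs} → All P xs → Sorted xs → Sorted (map f xs)
sorted-map f mono []         []          = []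
sorted-map f mono (px ∷ pxs) (x< ∷ xs↗) =
  All.map⁺ (All.zipWith (λ (py , x<y) → mono px py x<y) (pxs , x<)) ∷ sorted-map f mono pxs xs↗

below-map : ∀ {P Q : Word → Set} (f g : Word → Word) →
            (∀ {x y} → P x → Q y → f x <lex g y) →
            ∀ {xs ys} → All P xs → All Q ys → All (λ u → All (u <lex_) (map g ys)) (map f xs)
below-map f g lt pxs qys = All.map⁺ (All.map (λ px → All.map⁺ (All.map (lt px) qys)) pxs)

sorted-++ : ∀ {P Q : Word → Set} → (∀ {x y} → P x → Q y → x <lex y) →
            ∀ {xs ys} → All P xs → All Q ys → Sorted xs → Sorted ys → Sorted (xs ++ ys)
sorted-++ lt pxs qys xs↗ ys↗ =
  AllPairs.++⁺ xs↗ ys↗ (All.map (λ px → All.map (lt px) qys) pxs)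

-- The words of low and high have this shape
-- (lemma opens), and it is all that the block comparisons below need.
Opens : Bool → Word → Set
Opens b w = ∃ λ y → ∃ λ z → ∃ λ r → w ≡ b ∷ y ∷ z ∷ r × ¬ (b ≡ y × y ≡ z)

evenImage-opens : ∀ {b w} → Opens b w → Opens b (evenImage w)
evenImage-opens {b} (y , z , r , refl , _) =
  not b , y , evenImageTail y (z ∷ r) , refl , λ (e , _) → not-¬ refl e

oddImage-opens : ∀ {b w} → Opens b w → Opens (not b) (oddImage w)
oddImage-opens (y , z , r , refl , _) =
  y , not y , thue (z ∷ r) , refl , λ (_ , e) → not-¬ refl e

thue-mono : ∀ {x y} → x <lex y → thue x <lex thue y
thue-mono []<∷        = []<∷
thue-mono (here x<y)  = here x<y
thue-mono (there x<y) = there (there (thue-mono x<y))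

evenImage-mono : ∀ {x y} → x <lex y → evenImage x <lex evenImage y
evenImage-mono []<∷        = []<∷
evenImage-mono (here x<y)  = here x<y
evenImage-mono (there x<y) = there (tail-mono x<y)
  where
  tail-mono : ∀ {a xs ys} → xs <lex ys → evenImageTail a xs <lex evenImageTail a ys
  tail-mono []<∷        = []<∷
  tail-mono (here x<y)  = there (here x<y)
  tail-mono (there x<y) = there (there (tail-mono x<y))

-- oddImage complements the first letter, so it is monotone only on words
-- with a common first letter.
oddImage-mono : ∀ {b x y} → Opens b x → Opens b y → x <lex y → oddImage x <lex oddImage y
oddImage-mono (_ , _ , _ , refl , _) (_ , _ , _ , refl , _) (here (refl , ()))
oddImage-mono (_ , _ , _ , refl , _) (_ , _ , _ , refl , _) (there x<y) = there (thue-mono x<y)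

low-below-high : ∀ {x y} → Opens false x → Opens true y → x <lex y
low-below-high (_ , _ , _ , refl , _) (_ , _ , _ , refl , _) = here (refl , refl)

-- oddImage(1ab…) = 0 a ā b … lies below evenImage(0c…) = 0 1 c c̄ …,
-- using b = 0 when a = 1.
oddImage-below-evenImage : ∀ {x y} → Opens true x → Opens false y → oddImage x <lex evenImage y
oddImage-below-evenImage (false , _ , _ , refl , _) (_ , _ , _ , refl , _) =
  there (here (refl , refl))
oddImage-below-evenImage (true , false , _ , refl , _) (true , _ , _ , refl , _) =
  there (there (here (refl , refl)))
oddImage-below-evenImage (true , false , _ , refl , _) (false , _ , _ , refl , _) =
  there (there (there (here (refl , refl))))
oddImage-below-evenImage (true , true , _ , refl , cube) _ = ⊥-elim (cube (refl , refl))

-- evenImage(1a…) = 1 0 a ā … lies below oddImage(0cd…) = 1 c c̄ d …,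
-- using d = 1 when c = 0.
evenImage-below-oddImage : ∀ {x y} → Opens true x → Opens false y → evenImage x <lex oddImage y
evenImage-below-oddImage (_ , _ , _ , refl , _) (true , _ , _ , refl , _) =
  there (here (refl , refl))
evenImage-below-oddImage (false , _ , _ , refl , _) (false , true , _ , refl , _) =
  there (there (here (refl , refl)))
evenImage-below-oddImage (true , _ , _ , refl , _) (false , true , _ , refl , _) =
  there (there (there (here (refl , refl))))
evenImage-below-oddImage _ (false , false , _ , refl , cube) = ⊥-elim (cube (refl , refl))

q₁ q₂ q₄ : Word → Word
q₁ f = drop 1 f ++ true ∷ []
q₂ f = drop 2 f ++ true ∷ true ∷ []
q₄ f = drop 3 f ++ true ∷ true ∷ false ∷ []

ZeroEnded : Word → Set
ZeroEnded w = ∃ λ x → ∃ λ y → ∃ λ r → w ≡ x ∷ y ∷ (r ++ false ∷ [])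

zeroEnded-evenImage : ∀ {w} → ZeroEnded w → ZeroEnded (evenImage w)
zeroEnded-evenImage (x , y , r , refl) =
  x , not x , y ∷ not y ∷ thue r , evenImage-snoc (x ∷ y ∷ r) false

-- For f = evenImage w the images of w and of q₁ w are q₁ f, q₂ f and q₄ f;
-- the last letter 0 of w is what makes the appended suffixes agree.
oddImage≡q₁ : ∀ {w} → ZeroEnded w → oddImage w ≡ q₁ (evenImage w)
oddImage≡q₁ (x , y , r , refl) = begin
  not x ∷ y ∷ not y ∷ thue (r ++ false ∷ [])          ≡⟨ cong (λ u → not x ∷ y ∷ not y ∷ u) (thue-++ r _) ⟩
  not x ∷ y ∷ not y ∷ (thue r ++ false ∷ true ∷ [])   ≡⟨ cong (λ u → not x ∷ y ∷ not y ∷ u) (sym (++-assoc (thue r) _ _)) ⟩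
  q₁ (thue (x ∷ y ∷ r) ++ false ∷ [])                 ≡⟨ cong q₁ (sym (evenImage-snoc (x ∷ y ∷ r) false)) ⟩
  q₁ (evenImage (x ∷ y ∷ (r ++ false ∷ [])))          ∎
  where open ≡-Reasoning

evenImage∘q₁ : ∀ {w} → ZeroEnded w → evenImage (q₁ w) ≡ q₂ (evenImage w)
evenImage∘q₁ (x , y , r , refl) = begin
  evenImage ((y ∷ (r ++ false ∷ [])) ++ true ∷ [])           ≡⟨ evenImage-snoc (y ∷ (r ++ false ∷ [])) true ⟩
  y ∷ not y ∷ (thue (r ++ false ∷ []) ++ true ∷ [])          ≡⟨ cong (λ u → y ∷ not y ∷ (u ++ true ∷ [])) (thue-++ r _) ⟩
  y ∷ not y ∷ ((thue r ++ false ∷ true ∷ []) ++ true ∷ [])   ≡⟨ cong (λ u → y ∷ not y ∷ u) (++-assoc (thue r) _ _) ⟩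
  y ∷ not y ∷ (thue r ++ false ∷ true ∷ true ∷ [])           ≡⟨ cong (λ u → y ∷ not y ∷ u) (sym (++-assoc (thue r) _ _)) ⟩
  q₂ (thue (x ∷ y ∷ r) ++ false ∷ [])                        ≡⟨ cong q₂ (sym (evenImage-snoc (x ∷ y ∷ r) false)) ⟩
  q₂ (evenImage (x ∷ y ∷ (r ++ false ∷ [])))                 ∎
  where open ≡-Reasoning

oddImage∘q₁ : ∀ {w} → ZeroEnded w → oddImage (q₁ w) ≡ q₄ (evenImage w)
oddImage∘q₁ (x , y , r , refl) = begin
  not y ∷ thue ((r ++ false ∷ []) ++ true ∷ [])                ≡⟨ cong (not y ∷_) (thue-++ (r ++ false ∷ []) _) ⟩
  not y ∷ (thue (r ++ false ∷ []) ++ true ∷ false ∷ [])        ≡⟨ cong (λ u → not y ∷ (u ++ true ∷ false ∷ [])) (thue-++ r _) ⟩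
  not y ∷ ((thue r ++ false ∷ true ∷ []) ++ true ∷ false ∷ []) ≡⟨ cong (not y ∷_) (++-assoc (thue r) _ _) ⟩
  not y ∷ (thue r ++ false ∷ true ∷ true ∷ false ∷ [])         ≡⟨ cong (not y ∷_) (sym (++-assoc (thue r) _ _)) ⟩
  q₄ (thue (x ∷ y ∷ r) ++ false ∷ [])                          ≡⟨ cong q₄ (sym (evenImage-snoc (x ∷ y ∷ r) false)) ⟩
  q₄ (evenImage (x ∷ y ∷ (r ++ false ∷ [])))                   ∎
  where open ≡-Reasoning

size : ℕ → ℕ
size zero    = 2
size (suc j) = dbl (size j)

size≡2^ : ∀ j → size j ≡ 2 ^ suc j
size≡2^ zero    = refl
size≡2^ (suc j) = trans (dbl≡2* (size j)) (cong (2 *_) (size≡2^ j))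

-- The factors of length size j + 1 beginning with 0 (low) and with 1 (high),
-- each in increasing order; the sorted list of factors at the next level
-- consists of the four blocks described in the strategy.
low high : ℕ → List Word
low zero     = (false ∷ false ∷ true ∷ []) ∷ (false ∷ true ∷ false ∷ []) ∷ (false ∷ true ∷ true ∷ []) ∷ []
low (suc j)  = map oddImage (high j) ++ map evenImage (low j)
high zero    = (true ∷ false ∷ false ∷ []) ∷ (true ∷ false ∷ true ∷ []) ∷ (true ∷ true ∷ false ∷ []) ∷ []
high (suc j) = map evenImage (high j) ++ map oddImage (low j)

-- The words of low begin with 0, those of high with 1, and none begins with
-- a cube: evenImage keeps and oddImage flips the first letter.
opens : ∀ j → All (Opens false) (low j) × All (Opens true) (high j)
opens zero =
  (  (false , true , [] , refl , λ { (_ , ()) })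
   ∷ (true , false , [] , refl , λ { (() , _) })
   ∷ (true , true , [] , refl , λ { (() , _) }) ∷ [])
  , (  (false , false , [] , refl , λ { (() , _) })
     ∷ (false , true , [] , refl , λ { (() , _) })
     ∷ (true , false , [] , refl , λ { (_ , ()) }) ∷ [])
opens (suc j) with opens j
... | L , H =
    All.++⁺ (All.map⁺ (All.map oddImage-opens H)) (All.map⁺ (All.map evenImage-opens L))
  , All.++⁺ (All.map⁺ (All.map evenImage-opens H)) (All.map⁺ (All.map oddImage-opens L))

sorted : ∀ j → Sorted (low j) × Sorted (high j)
sorted zero =
    ((there (here (refl , refl)) ∷ there (here (refl , refl)) ∷ [])
     ∷ (there (there (here (refl , refl))) ∷ []) ∷ [] ∷ [])
  , ((there (there (here (refl , refl))) ∷ there (here (refl , refl)) ∷ [])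
     ∷ (there (here (refl , refl)) ∷ []) ∷ [] ∷ [])
sorted (suc j) with opens j | sorted j
... | L , H | L↗ , H↗ =
    AllPairs.++⁺ (sorted-map oddImage oddImage-mono H H↗)
                 (sorted-map evenImage (λ _ _ → evenImage-mono) L L↗)
                 (below-map oddImage evenImage oddImage-below-evenImage H L)
  , AllPairs.++⁺ (sorted-map evenImage (λ _ _ → evenImage-mono) H H↗)
                 (sorted-map oddImage oddImage-mono L L↗)
                 (below-map evenImage oddImage evenImage-below-oddImage H L)

enumeration-sorted : ∀ j → Sorted (low j ++ high j)
enumeration-sorted j =
  sorted-++ low-below-high (proj₁ (opens j)) (proj₂ (opens j)) (proj₁ (sorted j)) (proj₂ (sorted j))

enumeration-factors : ∀ j → All (Factor (size j)) (low j ++ high j)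
enumeration-factors j = All.++⁺ (proj₁ (factors j)) (proj₂ (factors j))
  where
  factors : ∀ j → All (Factor (size j)) (low j) × All (Factor (size j)) (high j)
  factors zero =
    ((5 , refl) ∷ (3 , refl) ∷ (0 , refl) ∷ []) , ((4 , refl) ∷ (2 , refl) ∷ (1 , refl) ∷ [])
  factors (suc j) with factors j
  ... | L , H =
      All.++⁺ (All.map⁺ (All.map factor-odd H)) (All.map⁺ (All.map factor-even L))
    , All.++⁺ (All.map⁺ (All.map factor-even H)) (All.map⁺ (All.map factor-odd L))

nonCube-∈ : ∀ a b c → ¬ (a ≡ b × b ≡ c) → (a ∷ b ∷ c ∷ []) ∈ low 0 ++ high 0
nonCube-∈ false false false cube = ⊥-elim (cube (refl , refl))
nonCube-∈ false false true  _    = here refl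
nonCube-∈ false true  false _    = there (here refl)
nonCube-∈ false true  true  _    = there (there (here refl))
nonCube-∈ true  false false _    = there (there (there (here refl)))
nonCube-∈ true  false true  _    = there (there (there (there (here refl))))
nonCube-∈ true  true  false _    = there (there (there (there (there (here refl)))))
nonCube-∈ true  true  true  cube = ⊥-elim (cube (refl , refl))

images-∈ : ∀ j {v} → v ∈ low j ++ high j →
           evenImage v ∈ low (suc j) ++ high (suc j) × oddImage v ∈ low (suc j) ++ high (suc j)
images-∈ j v∈ with ∈-++⁻ (low j) v∈
... | inj₁ v∈L = ∈-++⁺ˡ (∈-++⁺ʳ (map oddImage (high j)) (∈-map⁺ evenImage v∈L))
               , ∈-++⁺ʳ (low (suc j)) (∈-++⁺ʳ (map evenImage (high j)) (∈-map⁺ oddImage v∈L))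
... | inj₂ v∈H = ∈-++⁺ʳ (low (suc j)) (∈-++⁺ˡ (∈-map⁺ evenImage v∈H))
               , ∈-++⁺ˡ (∈-++⁺ˡ (∈-map⁺ oddImage v∈H))

-- Every factor is listed: at level 0 because t has no cube, and then since
-- each factor is an image of a factor of the previous level.
complete : ∀ j {w} → Factor (size j) w → w ∈ low j ++ high j
complete zero    (i , refl) = nonCube-∈ (tm i) (tm (suc i)) (tm (suc (suc i))) (TM.no-cube i)
complete (suc j) fw with factor-split fw
... | v , fv , inj₁ refl = proj₁ (images-∈ j (complete j fv))
... | v , fv , inj₂ refl = proj₂ (images-∈ j (complete j fv))

-- |low j| = |high j|: at every level both have length |high| + |low| of the
-- previous one.
balanced : ∀ j → length (low j) ≡ length (high j)
balanced zero    = refl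
balanced (suc j) = trans (images-length (high j) (low j)) (sym (images-length (high j) (low j)))
  where
  images-length : ∀ {f g : Word → Word} xs ys → length (map f xs ++ map g ys) ≡ length xs + length ys
  images-length {f} {g} xs ys =
    trans (length-++ (map f xs)) (cong₂ _+_ (length-map f xs) (length-map g ys))

Starts : ∀ {A : Set} → A → List A → Set
Starts x xs = ∃ λ r → xs ≡ x ∷ r

starts-map : ∀ {A B : Set} (f : A → B) {x xs} → Starts x xs → Starts (f x) (map f xs)
starts-map f (r , refl) = map f r , refl

starts-++ : ∀ {A : Set} {x : A} {xs ys} → Starts x xs → Starts x (xs ++ ys)
starts-++ {ys = ys} (r , refl) = r ++ ys , refl

prefix₁ : ℕ → Word
prefix₁ zero    = true ∷ false ∷ false ∷ []
prefix₁ (suc j) = evenImage (prefix₁ j)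

prefix₁-slice : ∀ j → slice tm₁ 0 (suc (size j)) ≡ prefix₁ j
prefix₁-slice zero    = refl
prefix₁-slice (suc j) = trans (sym (TM₁.evenImage-slice (size j) 0)) (cong evenImage (prefix₁-slice j))

prefix₁-zeroEnded : ∀ j → ZeroEnded (prefix₁ j)
prefix₁-zeroEnded zero    = true , false , [] , refl
prefix₁-zeroEnded (suc j) = zeroEnded-evenImage (prefix₁-zeroEnded j)

block-heads : ∀ {p xs ys} → ZeroEnded p → Starts p xs → Starts (q₁ p) ys →
              Starts (q₁ (evenImage p)) (map oddImage xs) × Starts (q₂ (evenImage p)) (map evenImage ys)
              × Starts (evenImage p) (map evenImage xs) × Starts (q₄ (evenImage p)) (map oddImage ys)
block-heads p0 hx hy =
    subst (λ u → Starts u _) (oddImage≡q₁ p0) (starts-map oddImage hx)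
  , subst (λ u → Starts u _) (evenImage∘q₁ p0) (starts-map evenImage hy)
  , starts-map evenImage hx
  , subst (λ u → Starts u _) (oddImage∘q₁ p0) (starts-map oddImage hy)

heads : ∀ j → Starts (q₁ (prefix₁ j)) (low j) × Starts (prefix₁ j) (high j)
heads zero    = (_ , refl) , (_ , refl)
heads (suc j) with heads j
... | L , H with block-heads (prefix₁-zeroEnded j) H L
...   | h₁ , _ , h₃ , _ = starts-++ h₁ , starts-++ h₃

Quarters : ∀ {A : Set} → List A → A → A → A → A → Set
Quarters S a b c d =
    (S ‼ (0 * (length S / 4)) ≡ just a) × (S ‼ (1 * (length S / 4)) ≡ just b)
  × (S ‼ (2 * (length S / 4)) ≡ just c) × (S ‼ (3 * (length S / 4)) ≡ just d)

starts-‼ : ∀ {A : Set} {x : A} {xs} → Starts x xs → xs ‼ 0 ≡ just x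
starts-‼ (_ , refl) = refl

‼-skip : ∀ {A : Set} (xs : List A) {ys n i} → length xs ≡ n → (xs ++ ys) ‼ (n + i) ≡ ys ‼ i
‼-skip []       refl = refl
‼-skip (x ∷ xs) refl = ‼-skip xs refl

quarter-heads : ∀ {A : Set} {a b c d : A} {n} {p q r s : List A} →
                Starts a p → Starts b q → Starts c r → Starts d s →
                length p ≡ n → length q ≡ n → length r ≡ n → length s ≡ n →
                Quarters ((p ++ q) ++ (r ++ s)) a b c d
quarter-heads {A} {a} {b} {c} {d} {n} {p} {q} {r} {s} ha hb hc hd |p| |q| |r| |s| =
  subst (λ S → Quarters S a b c d) (sym (++-assoc p q (r ++ s)))
        ( starts-‼ (starts-++ ha)
        , trans (at 1) (trans (‼-skip p |p|) (starts-‼ (starts-++ hb)))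
        , trans (at 2) (trans (‼-skip p |p|) (trans (‼-skip q |q|) (starts-‼ (starts-++ hc))))
        , trans (at 3) (trans (‼-skip p |p|) (trans (‼-skip q |q|) (trans (‼-skip r |r|) (starts-‼ hd)))))
  where
  S : List A
  S = p ++ (q ++ (r ++ s))
  open ≡-Reasoning
  |S| : length S ≡ n * 4
  |S| = begin
    length S                                         ≡⟨ length-++ p ⟩
    length p + length (q ++ (r ++ s))                ≡⟨ cong (length p +_) (length-++ q) ⟩
    length p + (length q + length (r ++ s))          ≡⟨ cong (λ m → length p + (length q + m)) (length-++ r) ⟩
    length p + (length q + (length r + length s))   ≡⟨ cong₂ _+_ |p| (cong₂ _+_ |q| (cong₂ _+_ |r| |s|)) ⟩
    n + (n + (n + n))                                ≡⟨ cong (λ m → n + (n + (n + m))) (sym (+-identityʳ n)) ⟩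
    4 * n                                            ≡⟨ *-comm 4 n ⟩
    n * 4                                            ∎
  at : ∀ k → S ‼ (k * (length S / 4)) ≡ S ‼ (k * n)
  at k = cong (λ m → S ‼ (k * m)) (trans (cong (_/ 4) |S|) (m*n/n≡m n 4))

window-level : ∀ s i j → window s i (2 ^ suc j + 1) ≡ slice s i (suc (size j))
window-level s i j =
  trans (window≡slice s i _) (cong (slice s i) (trans (+-comm (2 ^ suc j) 1) (cong suc (sym (size≡2^ j)))))

enumeration-unique : ∀ j ws → IsSortedEnumA (suc j) ws → ws ≡ low j ++ high j
enumeration-unique j ws (ws↗ , members) =
  sorted-unique (Linked⇒AllPairs lex-trans ws↗) (enumeration-sorted j)
    (λ w∈ws → complete j (toFactor (Equivalence.to (members _) w∈ws)))
    (λ w∈ → Equivalence.from (members _) (fromFactor (All.lookup (enumeration-factors j) w∈)))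
  where
  toFactor : ∀ {w} → IsFactor (2 ^ suc j + 1) w → Factor (size j) w
  toFactor (i , e) = i , trans e (window-level tm i j)
  fromFactor : ∀ {w} → Factor (size j) w → IsFactor (2 ^ suc j + 1) w
  fromFactor (i , e) = i , trans e (sym (window-level tm i j))

f₁≡prefix₁ : ∀ j → f₁ (suc j) ≡ prefix₁ j
f₁≡prefix₁ j = trans (window-level tm₁ 0 j) (prefix₁-slice j)

level-quarters : ∀ j → let f = prefix₁ (suc j) in
                 Quarters (low (suc j) ++ high (suc j)) (q₁ f) (q₂ f) f (q₄ f)
level-quarters j with heads j
... | L , H with block-heads (prefix₁-zeroEnded j) H L
...   | h₁ , h₂ , h₃ , h₄ =
  quarter-heads h₁ h₂ h₃ h₄
    (length-map oddImage (high j)) (trans (length-map evenImage (low j)) (balanced j))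
    (length-map evenImage (high j)) (trans (length-map oddImage (low j)) (balanced j))

proposition3 : (m : ℕ) → 2 ≤ m → (ws : List Word) → IsSortedEnumA m ws →
    (ws ‼ (0 * (length ws / 4)) ≡ just (drop 1 (f₁ m) ++ (true ∷ [])))
    × (ws ‼ (1 * (length ws / 4)) ≡ just (drop 2 (f₁ m) ++ (true ∷ true ∷ [])))
    × (ws ‼ (2 * (length ws / 4)) ≡ just (f₁ m))
    × (ws ‼ (3 * (length ws / 4)) ≡ just (drop 3 (f₁ m) ++ (true ∷ true ∷ false ∷ [])))
proposition3 (suc (suc j)) (s≤s (s≤s z≤n)) ws enum =
  subst₂ (λ S f → Quarters S (q₁ f) (q₂ f) f (q₄ f))
         (sym (enumeration-unique (suc j) ws enum)) (sym (f₁≡prefix₁ (suc j))) (level-quarters j)
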